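{- For every nonnegative integer $n$ and every complex number $x$, $${}_3F_2\left[\begin{matrix} 3x,\ 1-3x,\ -n\\ \tfrac32,\ -1-3n\end{matrix}\middle|\frac34\right]=\frac{3x}{6x-1}\left[\begin{matrix} 1+x,\ 1-x\\ \frac23,\ \frac43\end{matrix}\right]_n+\frac{3x-1}{6x-1}\left[\begin{matrix} \frac23+x,\ \frac43-x\\ \frac23,\ \frac43\end{matrix}\right]_n.$$
   Context: For a complex number $a$ and a nonnegative integer $m$, $(a)_m=a(a+1)\cdots(a+m-1)$ with $(a)_0=1$. The bracket notation means $\left[\begin{matrix} a_1,\dots,a_r\\ b_1,\dots,b_s\end{matrix}\right]_m=\frac{(a_1)_m\cdots(a_r)_m}{(b_1)_m\cdots(b_s)_m}$. For a nonnegative integer $n$, ${}_3F_2\left[\begin{matrix} a,\ b,\ -n\\ d,\ e\end{matrix}\middle|z\right]=\sum_{k=0}^{n}\frac{(a)_k(b)_k(-n)_k}{k!\,(d)_k(e)_k}z^k$. The identity is understood for values of $x$ for which no denominator vanishes. -}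

module Defs where

open import Level using (_⊔_)
open import Data.Nat as ℕ using (ℕ; zero; suc)
open import Data.Nat.Base using (_!)
open import Relation.Nullary using (¬_)
open import Algebra.Bundles using (CommutativeRing)

module _ {c ℓ} (R : CommutativeRing c ℓ) where
  open CommutativeRing R using (Carrier; _+_; 0#; 1#)
  embedℕ : ℕ → Carrier
  embedℕ zero    = 0#
  embedℕ (suc n) = 1# + embedℕ n

-- A field of characteristic zero, with a total inverse following the usual
-- convention 0⁻¹ = 0 (the convention only makes division total; the statement
-- explicitly assumes the only x-dependent denominator 6x-1 is nonzero, and all
-- other denominators are nonzero automatically in characteristic zero).
record CharZeroField (c ℓ : Level.Level) : Set (Level.suc (c ⊔ ℓ)) where
  field
    commutativeRing : CommutativeRing c ℓ
  open CommutativeRing commutativeRing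
  field
    _⁻¹        : Carrier → Carrier
    ⁻¹-cong    : ∀ {x y} → x ≈ y → x ⁻¹ ≈ y ⁻¹
    ⁻¹-inverse : ∀ x → ¬ (x ≈ 0#) → x * (x ⁻¹) ≈ 1#
    ⁻¹-zero    : (0# ⁻¹) ≈ 0#
    charZero   : ∀ n → ¬ (embedℕ commutativeRing (suc n) ≈ 0#)
  infix 8 _⁻¹

module FieldOps {c ℓ} (K : CharZeroField c ℓ) where
  open CharZeroField K public
  open CommutativeRing commutativeRing public
    using (Carrier; _≈_; _+_; _*_; -_; _-_; 0#; 1#; setoid; ring)

  ι : ℕ → Carrier
  ι = embedℕ commutativeRing

  infixl 7 _/_
  _/_ : Carrier → Carrier → Carrier
  x / y = x * (y ⁻¹)

  _^_ : Carrier → ℕ → Carrier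
  x ^ zero  = 1#
  x ^ suc m = x * (x ^ m)

  poch : Carrier → ℕ → Carrier
  poch a zero    = 1#
  poch a (suc m) = poch a m * (a + ι m)

  sumTo : ℕ → (ℕ → Carrier) → Carrier
  sumTo zero    f = f zero
  sumTo (suc n) f = sumTo n f + f (suc n)

  F32 : Carrier → Carrier → ℕ → Carrier → Carrier → Carrier → Carrier
  F32 a b n d e z =
    sumTo n (λ k → (poch a k * poch b k * poch (- ι n) k) * (z ^ k)
                   / (ι (k !) * poch d k * poch e k))

  bracket2 : Carrier → Carrier → Carrier → Carrier → ℕ → Carrier
  bracket2 a₁ a₂ b₁ b₂ m = (poch a₁ m * poch a₂ m) / (poch b₁ m * poch b₂ m)

module Submission where

-- Both sides satisfy one second-order recurrence c₀ S(n) + c₁ S(n+1) + c₂ S(n+2) = 0 with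
-- c₂ ≠ 0, so they agree once they agree at n = 0, 1, 2. For the ₃F₂ sum the recurrence comes
-- from creative telescoping: the summands of S(n), S(n+1), S(n+2) are polynomial multiples of
-- one hypergeometric term V(k), and c₀ t(n,k) + c₁ t(n+1,k) + c₂ t(n+2,k) = G(k+1) - G(k) with
-- G(k) = V(k) R(k), so the sum over k telescopes to zero. Each bracket on the right is a
-- first-order hypergeometric sequence in n, for which the recurrence is a polynomial identity.

open import Defs
open import Data.Nat as ℕ using (ℕ; zero; suc; _≤_; _<_; z≤n; s≤s)
import Data.Nat.Properties as ℕ
open import Data.Integer as ℤ using (ℤ; +_; -[1+_])
import Data.Integer.Properties as ℤ
open import Data.Sign as Sign using (Sign)
open import Data.Maybe using (Maybe; just; nothing)
open import Data.Sum using (inj₁; inj₂)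
open import Relation.Nullary using (¬_; yes; no)
import Relation.Binary.PropositionalEquality as ≡
open import Algebra.Bundles using (CommutativeRing)
open import Algebra.Solver.Ring.AlmostCommutativeRing
  using (fromCommutativeRing; _-Raw-AlmostCommutative⟶_)
import Algebra.Solver.Ring as Solver

module IntegerCoefficients {c ℓ} (R : CommutativeRing c ℓ) where
  open CommutativeRing R
  open import Algebra.Properties.Ring ring using (-‿involutive; -‿+-comm; -0#≈0#; -‿distribˡ-*; -‿distribʳ-*)
  open import Algebra.Properties.Semiring.Mult semiring using (_×_; ×-homo-+; ×1-homo-*)
  open import Relation.Binary.Reasoning.Setoid setoid

  ι : ℕ → Carrier
  ι = embedℕ R

  ι≈×1# : ∀ n → ι n ≈ n × 1#
  ι≈×1# zero    = refl
  ι≈×1# (suc n) = +-congˡ (ι≈×1# n)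

  ι-homo-+ : ∀ m n → ι (m ℕ.+ n) ≈ ι m + ι n
  ι-homo-+ m n = begin
    ι (m ℕ.+ n)       ≈⟨ ι≈×1# (m ℕ.+ n) ⟩
    (m ℕ.+ n) × 1#    ≈⟨ ×-homo-+ 1# m n ⟩
    m × 1# + n × 1#   ≈⟨ +-cong (ι≈×1# m) (ι≈×1# n) ⟨
    ι m + ι n         ∎

  ι-homo-* : ∀ m n → ι (m ℕ.* n) ≈ ι m * ι n
  ι-homo-* m n = begin
    ι (m ℕ.* n)            ≈⟨ ι≈×1# (m ℕ.* n) ⟩
    (m ℕ.* n) × 1#         ≈⟨ ×1-homo-* m n ⟩
    (m × 1#) * (n × 1#)    ≈⟨ *-cong (ι≈×1# m) (ι≈×1# n) ⟨
    ι m * ι n              ∎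

  -- The interpretation of solver constants: 1 goes to 1# itself rather than to ι 1 = 1# + 0#,
  -- so that con (+ 1) denotes 1# on the nose; every other constant n denotes ι n.
  ιᶻ : ℕ → Carrier
  ιᶻ 1 = 1#
  ιᶻ n = ι n

  ιᶻ≈ι : ∀ n → ιᶻ n ≈ ι n
  ιᶻ≈ι 0             = refl
  ιᶻ≈ι 1             = sym (+-identityʳ 1#)
  ιᶻ≈ι (suc (suc n)) = refl

  fromℤ : ℤ → Carrier
  fromℤ (+ n)      = ιᶻ n
  fromℤ -[1+ n ]   = - ιᶻ (suc n)

  signed : Sign → Carrier → Carrier
  signed Sign.+ x = x
  signed Sign.- x = - x

  signed-cong : ∀ s {x y} → x ≈ y → signed s x ≈ signed s y
  signed-cong Sign.+ x≈y = x≈y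
  signed-cong Sign.- x≈y = -‿cong x≈y

  fromℤ-◃ : ∀ s n → fromℤ (s ℤ.◃ n) ≈ signed s (ι n)
  fromℤ-◃ Sign.+ zero    = refl
  fromℤ-◃ Sign.- zero    = sym -0#≈0#
  fromℤ-◃ Sign.+ (suc n) = ιᶻ≈ι (suc n)
  fromℤ-◃ Sign.- (suc n) = -‿cong (ιᶻ≈ι (suc n))

  fromℤ-signAbs : ∀ i → fromℤ i ≈ signed (ℤ.sign i) (ι ℤ.∣ i ∣)
  fromℤ-signAbs i = begin
    fromℤ i                                  ≡⟨ ≡.cong fromℤ (ℤ.◃-inverse i) ⟨
    fromℤ (ℤ.sign i ℤ.◃ ℤ.∣ i ∣)             ≈⟨ fromℤ-◃ (ℤ.sign i) ℤ.∣ i ∣ ⟩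
    signed (ℤ.sign i) (ι ℤ.∣ i ∣)            ∎

  signed-* : ∀ s t x y → signed (s Sign.* t) (x * y) ≈ signed s x * signed t y
  signed-* Sign.+ Sign.+ x y = refl
  signed-* Sign.+ Sign.- x y = -‿distribʳ-* x y
  signed-* Sign.- Sign.+ x y = -‿distribˡ-* x y
  signed-* Sign.- Sign.- x y = begin
    x * y           ≈⟨ -‿involutive (x * y) ⟨
    - - (x * y)     ≈⟨ -‿cong (-‿distribˡ-* x y) ⟩
    - (- x * y)     ≈⟨ -‿distribʳ-* (- x) y ⟩
    - x * - y       ∎

  fromℤ-⊖ : ∀ m n → fromℤ (m ℤ.⊖ n) ≈ ι m - ι n
  fromℤ-⊖ m       zero    = begin
    ιᶻ m            ≈⟨ ιᶻ≈ι m ⟩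
    ι m             ≈⟨ +-identityʳ (ι m) ⟨
    ι m + 0#        ≈⟨ +-congˡ -0#≈0# ⟨
    ι m - 0#        ∎
  fromℤ-⊖ zero    (suc n) = begin
    - ιᶻ (suc n)    ≈⟨ -‿cong (ιᶻ≈ι (suc n)) ⟩
    - ι (suc n)     ≈⟨ +-identityˡ _ ⟨
    0# - ι (suc n)  ∎
  fromℤ-⊖ (suc m) (suc n) = begin
    fromℤ (suc m ℤ.⊖ suc n)      ≡⟨ ≡.cong fromℤ (ℤ.[1+m]⊖[1+n]≡m⊖n m n) ⟩
    fromℤ (m ℤ.⊖ n)              ≈⟨ fromℤ-⊖ m n ⟩
    ι m - ι n                    ≈⟨ +-identityˡ _ ⟨
    0# + (ι m - ι n)             ≈⟨ +-congʳ (-‿inverseʳ 1#) ⟨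
    (1# - 1#) + (ι m - ι n)      ≈⟨ +-assoc 1# (- 1#) _ ⟩
    1# + (- 1# + (ι m - ι n))    ≈⟨ +-congˡ (+-assoc (- 1#) (ι m) _) ⟨
    1# + ((- 1# + ι m) - ι n)    ≈⟨ +-congˡ (+-congʳ (+-comm (- 1#) (ι m))) ⟩
    1# + ((ι m - 1#) - ι n)      ≈⟨ +-congˡ (+-assoc (ι m) (- 1#) _) ⟩
    1# + (ι m + (- 1# - ι n))    ≈⟨ +-assoc 1# (ι m) _ ⟨
    (1# + ι m) + (- 1# - ι n)    ≈⟨ +-congˡ (-‿+-comm 1# (ι n)) ⟩
    (1# + ι m) - (1# + ι n)      ∎

  fromℤ-homo-+ : ∀ i j → fromℤ (i ℤ.+ j) ≈ fromℤ i + fromℤ j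
  fromℤ-homo-+ (+ m)    (+ n)    = begin
    ιᶻ (m ℕ.+ n)                 ≈⟨ ιᶻ≈ι (m ℕ.+ n) ⟩
    ι (m ℕ.+ n)                  ≈⟨ ι-homo-+ m n ⟩
    ι m + ι n                    ≈⟨ +-cong (ιᶻ≈ι m) (ιᶻ≈ι n) ⟨
    ιᶻ m + ιᶻ n                  ∎
  fromℤ-homo-+ (+ m)    -[1+ n ] = begin
    fromℤ (m ℤ.⊖ suc n)          ≈⟨ fromℤ-⊖ m (suc n) ⟩
    ι m - ι (suc n)              ≈⟨ +-cong (ιᶻ≈ι m) (-‿cong (ιᶻ≈ι (suc n))) ⟨
    ιᶻ m - ιᶻ (suc n)            ∎
  fromℤ-homo-+ -[1+ m ] (+ n)    = begin
    fromℤ (n ℤ.⊖ suc m)          ≈⟨ fromℤ-⊖ n (suc m) ⟩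
    ι n - ι (suc m)              ≈⟨ +-comm (ι n) _ ⟩
    - ι (suc m) + ι n            ≈⟨ +-cong (-‿cong (ιᶻ≈ι (suc m))) (ιᶻ≈ι n) ⟨
    - ιᶻ (suc m) + ιᶻ n          ∎
  fromℤ-homo-+ -[1+ m ] -[1+ n ] = begin
    - ι (suc (suc (m ℕ.+ n)))    ≡⟨ ≡.cong (λ k → - ι (suc k)) (ℕ.+-suc m n) ⟨
    - ι (suc m ℕ.+ suc n)        ≈⟨ -‿cong (ι-homo-+ (suc m) (suc n)) ⟩
    - (ι (suc m) + ι (suc n))    ≈⟨ -‿+-comm (ι (suc m)) (ι (suc n)) ⟨
    - ι (suc m) - ι (suc n)      ≈⟨ +-cong (-‿cong (ιᶻ≈ι (suc m))) (-‿cong (ιᶻ≈ι (suc n))) ⟨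
    - ιᶻ (suc m) - ιᶻ (suc n)    ∎

  fromℤ-homo-* : ∀ i j → fromℤ (i ℤ.* j) ≈ fromℤ i * fromℤ j
  fromℤ-homo-* i j = begin
    fromℤ (i ℤ.* j)                                          ≈⟨ fromℤ-◃ (ℤ.sign i Sign.* ℤ.sign j) (ℤ.∣ i ∣ ℕ.* ℤ.∣ j ∣) ⟩
    signed (ℤ.sign i Sign.* ℤ.sign j) (ι (ℤ.∣ i ∣ ℕ.* ℤ.∣ j ∣)) ≈⟨ signed-cong (ℤ.sign i Sign.* ℤ.sign j) (ι-homo-* ℤ.∣ i ∣ ℤ.∣ j ∣) ⟩
    signed (ℤ.sign i Sign.* ℤ.sign j) (ι ℤ.∣ i ∣ * ι ℤ.∣ j ∣)  ≈⟨ signed-* (ℤ.sign i) (ℤ.sign j) _ _ ⟩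
    signed (ℤ.sign i) (ι ℤ.∣ i ∣) * signed (ℤ.sign j) (ι ℤ.∣ j ∣) ≈⟨ *-cong (fromℤ-signAbs i) (fromℤ-signAbs j) ⟨
    fromℤ i * fromℤ j                                          ∎

  fromℤ-homo-neg : ∀ i → fromℤ (ℤ.- i) ≈ - fromℤ i
  fromℤ-homo-neg (+ zero)  = sym -0#≈0#
  fromℤ-homo-neg (+ suc n) = refl
  fromℤ-homo-neg -[1+ n ]  = sym (-‿involutive _)

  ℤ⟶R : ℤ.+-*-rawRing -Raw-AlmostCommutative⟶ fromCommutativeRing R
  ℤ⟶R = record
    { ⟦_⟧    = fromℤ
    ; +-homo = fromℤ-homo-+
    ; *-homo = fromℤ-homo-*
    ; -‿homo = fromℤ-homo-neg
    ; 0-homo = refl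
    ; 1-homo = refl
    }

  fromℤ-≟ : ∀ i j → Maybe (fromℤ i ≈ fromℤ j)
  fromℤ-≟ i j with i ℤ.≟ j
  ... | yes ≡.refl = just refl
  ... | no _       = nothing

  open Solver ℤ.+-*-rawRing (fromCommutativeRing R) ℤ⟶R fromℤ-≟ public
    using (solve; _:=_; Polynomial; con; _:+_; _:*_; :-_)

-- Ring expressions are written against RingSyntax: the same text then denotes an element of
-- the field (for the instance built from the field) and, inside a call to solve, the solver's
-- syntax tree of that element, so every polynomial below is written exactly once.
record RingSyntax {a} (A : Set a) : Set a where
  infixl 6 _+_ _-_
  infixl 7 _*_
  infix  8 -_
  field
    _+_ _*_ : A → A → A
    -_      : A → A
    0# 1#   : A
    ι       : ℕ → A

  _-_ : A → A → A
  x - y = x + - y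

module Polynomials {a} {A : Set a} {{_ : RingSyntax A}} where
  open RingSyntax {{...}}

  product< : ℕ → (ℕ → A) → A
  product< zero    f = 1#
  product< (suc k) f = product< k f * f k

  -- Writing t(j,k) for the k-th term of the ₃F₂ sum with -n = -j, the ratio t(j,k+1)/t(j,k)
  -- is termNum x j k / termDen j k (both carry an extra factor 4).
  termNum : A → A → A → A
  termNum X J K = ι 3 * (ι 3 * X + K) * (1# - ι 3 * X + K) * (K - J)

  termDen : A → A → A
  termDen J K = ι 2 * (1# + K) * (ι 2 * K + ι 3) * (K - (1# + ι 3 * J))

  -- The two brackets on the right have ratios bracketNumᵢ x n / bracketDen n (both times 9).
  bracketNum₁ bracketNum₂ : A → A → A
  bracketNum₁ X N = ι 9 * ((1# + X + N) * (1# - X + N))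
  bracketNum₂ X N = (ι 3 * N + ι 2 + ι 3 * X) * (ι 3 * N + ι 4 - ι 3 * X)

  bracketDen : A → A
  bracketDen N = (ι 3 * N + ι 2) * (ι 3 * N + ι 4)

  -- Zeilberger's recurrence c₀ S(n) + c₁ S(n+1) + c₂ S(n+2) = 0 for the ₃F₂ sum S, and its
  -- certificate R: summed over k, the identity telescoping-certificate below telescopes.
  e₀ e₁ : A → A → A
  e₀ X N = ι 81 * ((1# + N) * (1# + N) - X * X) * (ι 3 * N + ι 2 + ι 3 * X) * (ι 3 * N + ι 4 - ι 3 * X)
  e₁ X N = - (ι 3 * ((ι 3 * N + ι 5 + ι 3 * X) * (ι 3 * N + ι 7 - ι 3 * X) + ι 9 * ((1# + N) * (1# + N) - X * X)))

  c₀ c₁ : A → A → A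
  c₀ X N = e₀ X N * ((1# + N) * (ι 2 + N))
  c₁ X N = e₁ X N * ((ι 2 + N) * (ι 3 * N + ι 2) * (ι 3 * N + ι 3) * (ι 3 * N + ι 4))

  c₂ : A → A
  c₂ N = (ι 3 * N + ι 2) * (ι 3 * N + ι 3) * (ι 3 * N + ι 4) * (ι 3 * N + ι 5) * (ι 3 * N + ι 6) * (ι 3 * N + ι 7)

  -- t(n,k), t(n+1,k), t(n+2,k) are proportional to V(k) p₀(k), V(k) p₁(k), V(k) p₂(k) for one
  -- hypergeometric term V.
  p₀ p₁ p₂ : A → A → A
  p₀ N K = (1# + N - K) * (ι 2 + N - K)
  p₁ N K = (K - (1# + (1# + N))) * (K - ι 3 * N - ι 4) * (K - ι 3 * N - ι 3) * (K - ι 3 * N - ι 2)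
  p₂ N K = (K - ι 3 * N - ι 2) * (K - ι 3 * N - ι 3) * (K - ι 3 * N - ι 4)
         * (K - ι 3 * N - ι 5) * (K - ι 3 * N - ι 6) * (K - ι 3 * N - ι 7)

  P R : A → A → A → A
  P X N K = e₀ X N * p₀ N K + e₁ X N * p₁ N K + p₂ N K
  R X N K = K * (ι 2 * K + 1#) * (K - ι 3 * N - ι 2)
          * (ι 12 - ι 52 * K + ι 30 * K * K - ι 2 * K * K * K + ι 12 * N - ι 42 * N * K + ι 18 * N * K * K
             + ι 6 * (ι 3 * X * (1# - ι 3 * X)) * (K - N - ι 2))

module _ {c ℓ} (𝔽 : CharZeroField c ℓ) where
  open FieldOps 𝔽 hiding (_+_; _*_; -_; _-_; 0#; 1#; ι)
  open CommutativeRing commutativeRing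
    using (_≉_; refl; sym; trans; +-cong; +-congˡ; +-congʳ; *-cong; *-congˡ; *-congʳ;
           *-assoc; *-comm; +-identityʳ; *-identityˡ; *-identityʳ;
           -‿cong; -‿inverseˡ; zeroˡ; zeroʳ; distribˡ; *-commutativeSemigroup)
  open import Algebra.Properties.Ring ring using (-0#≈0#; -‿involutive; +-inverseʳ-unique)
  open import Algebra.Properties.CommutativeSemigroup *-commutativeSemigroup using (interchange; x∙yz≈y∙xz)
  open import Relation.Binary.Reasoning.Setoid setoid
  open IntegerCoefficients commutativeRing
    using (ι-homo-+; ι-homo-*; solve; _:=_; Polynomial; con; _:+_; _:*_; :-_)
  open RingSyntax {{...}}
  open Polynomials
  open import Data.Product using (_×_; _,_; proj₁)

  instance
    fieldSyntax : RingSyntax Carrier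
    fieldSyntax = record
      { _+_ = FieldOps._+_ 𝔽 ; _*_ = FieldOps._*_ 𝔽 ; -_ = FieldOps.-_ 𝔽
      ; 0# = FieldOps.0# 𝔽 ; 1# = FieldOps.1# 𝔽 ; ι = FieldOps.ι 𝔽 }

    -- The solver reads con (+ 1) as 1#, so the numeral ι 1 = 1# + 0# is spelled out.
    polynomialSyntax : ∀ {m} → RingSyntax (Polynomial m)
    polynomialSyntax = record
      { _+_ = _:+_ ; _*_ = _:*_ ; -_ = :-_ ; 0# = con (+ 0) ; 1# = con (+ 1) ; ι = numeral }
      where
      numeral : ℕ → Polynomial _
      numeral 1 = con (+ 1) :+ con (+ 0)
      numeral n = con (+ n)

  ≉0-cong : ∀ {u v} → u ≈ v → u ≉ 0# → v ≉ 0#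
  ≉0-cong u≈v u≉0 v≈0 = u≉0 (trans u≈v v≈0)

  ≉0-*ˡ : ∀ {u v} → u * v ≉ 0# → u ≉ 0#
  ≉0-*ˡ uv≉0 u≈0 = uv≉0 (trans (*-congʳ u≈0) (zeroˡ _))

  -‿≉0 : ∀ {u} → u ≉ 0# → - u ≉ 0#
  -‿≉0 {u} u≉0 -u≈0 = u≉0 (begin
    u        ≈⟨ -‿involutive u ⟨
    - - u    ≈⟨ -‿cong -u≈0 ⟩
    - 0#     ≈⟨ -0#≈0# ⟩
    0#       ∎)

  *-cancelʳ : ∀ {u v w} → w ≉ 0# → u * w ≈ v * w → u ≈ v
  *-cancelʳ {u} {v} {w} w≉0 uw≈vw = begin
    u                ≈⟨ *-identityʳ u ⟨
    u * 1#           ≈⟨ *-congˡ (⁻¹-inverse w w≉0) ⟨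
    u * (w * w ⁻¹)   ≈⟨ *-assoc u w _ ⟨
    u * w * w ⁻¹     ≈⟨ *-congʳ uw≈vw ⟩
    v * w * w ⁻¹     ≈⟨ *-assoc v w _ ⟩
    v * (w * w ⁻¹)   ≈⟨ *-congˡ (⁻¹-inverse w w≉0) ⟩
    v * 1#           ≈⟨ *-identityʳ v ⟩
    v                ∎

  *-cancelˡ : ∀ {u v w} → w ≉ 0# → w * u ≈ w * v → u ≈ v
  *-cancelˡ {u} {v} {w} w≉0 wu≈wv = *-cancelʳ w≉0 (trans (*-comm u w) (trans wu≈wv (*-comm w v)))

  *-≉0 : ∀ {u v} → u ≉ 0# → v ≉ 0# → u * v ≉ 0#
  *-≉0 {u} {v} u≉0 v≉0 uv≈0 = v≉0 (*-cancelˡ u≉0 (trans uv≈0 (sym (zeroʳ u))))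

  /-*-cancel : ∀ {u v} → v ≉ 0# → u / v * v ≈ u
  /-*-cancel {u} {v} v≉0 = begin
    u * v ⁻¹ * v     ≈⟨ *-assoc u _ v ⟩
    u * (v ⁻¹ * v)   ≈⟨ *-congˡ (*-comm _ v) ⟩
    u * (v * v ⁻¹)   ≈⟨ *-congˡ (⁻¹-inverse v v≉0) ⟩
    u * 1#           ≈⟨ *-identityʳ u ⟩
    u                ∎

  ⁻¹-unique : ∀ {u v} → u ≉ 0# → u * v ≈ 1# → v ≈ u ⁻¹
  ⁻¹-unique {u} {v} u≉0 uv≈1 = *-cancelˡ u≉0 (trans uv≈1 (sym (⁻¹-inverse u u≉0)))

  ⁻¹-homo-* : ∀ {u v} → u ≉ 0# → v ≉ 0# → (u * v) ⁻¹ ≈ u ⁻¹ * v ⁻¹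
  ⁻¹-homo-* {u} {v} u≉0 v≉0 = sym (⁻¹-unique (*-≉0 u≉0 v≉0) (begin
    u * v * (u ⁻¹ * v ⁻¹)           ≈⟨ solve 4 (λ u v u′ v′ → u * v * (u′ * v′) := u * u′ * (v * v′)) refl u v (u ⁻¹) (v ⁻¹) ⟩
    u * u ⁻¹ * (v * v ⁻¹)           ≈⟨ *-cong (⁻¹-inverse u u≉0) (⁻¹-inverse v v≉0) ⟩
    1# * 1#                         ≈⟨ *-identityˡ 1# ⟩
    1#                              ∎))

  1#≉0# : 1# ≉ 0#
  1#≉0# = ≉0-cong (+-identityʳ 1#) (charZero 0)

  1⁻¹≈1 : 1# ⁻¹ ≈ 1#
  1⁻¹≈1 = sym (⁻¹-unique 1#≉0# (*-identityˡ 1#))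

  ratio-of-quotients : ∀ {u v f g} → v ≉ 0# → g ≉ 0# → (u * f) / (v * g) * g ≈ u / v * f
  ratio-of-quotients {u} {v} {f} {g} v≉0 g≉0 = begin
    u * f * (v * g) ⁻¹ * g          ≈⟨ *-congʳ (*-congˡ (⁻¹-homo-* v≉0 g≉0)) ⟩
    u * f * (v ⁻¹ * g ⁻¹) * g       ≈⟨ solve 5 (λ u f v′ g′ g → u * f * (v′ * g′) * g := u * v′ * f * (g * g′))
                                               refl u f (v ⁻¹) (g ⁻¹) g ⟩
    u * v ⁻¹ * f * (g * g ⁻¹)       ≈⟨ *-congˡ (⁻¹-inverse g g≉0) ⟩
    u * v ⁻¹ * f * 1#               ≈⟨ *-identityʳ _ ⟩
    u * v ⁻¹ * f                    ∎

  ratio-scale : ∀ {u v f g} w → u * g ≈ v * f → u * (w * g) ≈ v * (w * f)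
  ratio-scale {u} {v} {f} {g} w ug≈vf = begin
    u * (w * g)     ≈⟨ x∙yz≈y∙xz u w g ⟩
    w * (u * g)     ≈⟨ *-congˡ ug≈vf ⟩
    w * (v * f)     ≈⟨ x∙yz≈y∙xz w v f ⟩
    v * (w * f)     ∎

  ι-affine≉0 : ∀ m i r → ι m * ι i + ι (suc r) ≉ 0#
  ι-affine≉0 m i r = ≉0-cong (begin
    ι (suc (m ℕ.* i ℕ.+ r))         ≡⟨ ≡.cong ι (ℕ.+-suc (m ℕ.* i) r) ⟨
    ι (m ℕ.* i ℕ.+ suc r)           ≈⟨ ι-homo-+ (m ℕ.* i) (suc r) ⟩
    ι (m ℕ.* i) + ι (suc r)         ≈⟨ +-congʳ (ι-homo-* m i) ⟩
    ι m * ι i + ι (suc r)           ∎) (charZero (m ℕ.* i ℕ.+ r))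

  shift≉0 : ∀ {t} m r → t * ι m ≈ ι (suc r) → ∀ i → t + ι i ≉ 0#
  shift≉0 {t} m r tm≈ i = ≉0-*ˡ (≉0-cong (begin
    ι m * ι i + ι (suc r)           ≈⟨ +-congˡ tm≈ ⟨
    ι m * ι i + t * ι m             ≈⟨ solve 3 (λ t m i → m * i + t * m := (t + i) * m) refl t (ι m) (ι i) ⟩
    (t + ι i) * ι m                 ∎) (ι-affine≉0 m i r))

  !≉0 : ∀ k → ι (k ℕ.!) ≉ 0#
  !≉0 zero    = charZero 0
  !≉0 (suc k) = ≉0-cong (sym (ι-homo-* (suc k) (k ℕ.!))) (*-≉0 (charZero k) (!≉0 k))

  poch≉0 : ∀ u k → (∀ i → i < k → u + ι i ≉ 0#) → poch u k ≉ 0#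
  poch≉0 u zero    _     = 1#≉0#
  poch≉0 u (suc k) u+i≉0 = *-≉0 (poch≉0 u k (λ i i<k → u+i≉0 i (ℕ.m<n⇒m<1+n i<k))) (u+i≉0 k ℕ.≤-refl)

  product<≉0 : ∀ k (f : ℕ → Carrier) → (∀ i → i < k → f i ≉ 0#) → product< k f ≉ 0#
  product<≉0 zero    f _     = 1#≉0#
  product<≉0 (suc k) f f≉0 = *-≉0 (product<≉0 k f (λ i i<k → f≉0 i (ℕ.m<n⇒m<1+n i<k))) (f≉0 k ℕ.≤-refl)

  poch-neg-vanishes : ∀ j k → j < k → poch (- ι j) k ≈ 0#
  poch-neg-vanishes j (suc k) (s≤s j≤k) with ℕ.m≤n⇒m<n∨m≡n j≤k
  ... | inj₁ j<k    = trans (*-congʳ (poch-neg-vanishes j k j<k)) (zeroˡ _)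
  ... | inj₂ ≡.refl = trans (*-congˡ (-‿inverseˡ (ι j))) (zeroʳ _)

  bracket2-at-0 : ∀ a₁ a₂ b₁ b₂ → bracket2 a₁ a₂ b₁ b₂ 0 ≈ 1#
  bracket2-at-0 a₁ a₂ b₁ b₂ = begin
    1# * 1# * (1# * 1#) ⁻¹      ≈⟨ *-cong (*-identityˡ 1#) (trans (⁻¹-cong (*-identityˡ 1#)) 1⁻¹≈1) ⟩
    1# * 1#                     ≈⟨ *-identityˡ 1# ⟩
    1#                          ∎

  bracket2-ratio : ∀ a₁ a₂ b₁ b₂ → (∀ i → b₁ + ι i ≉ 0#) → (∀ i → b₂ + ι i ≉ 0#) → ∀ n →
    bracket2 a₁ a₂ b₁ b₂ (suc n) * ((b₁ + ι n) * (b₂ + ι n)) ≈ bracket2 a₁ a₂ b₁ b₂ n * ((a₁ + ι n) * (a₂ + ι n))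
  bracket2-ratio a₁ a₂ b₁ b₂ b₁+i≉0 b₂+i≉0 n = begin
    (poch a₁ n * (a₁ + ι n) * (poch a₂ n * (a₂ + ι n))) / (poch b₁ n * (b₁ + ι n) * (poch b₂ n * (b₂ + ι n))) * G
      ≈⟨ *-congʳ (*-cong (interchange _ _ _ _) (⁻¹-cong (interchange _ _ _ _))) ⟩
    (poch a₁ n * poch a₂ n * F) / (poch b₁ n * poch b₂ n * G) * G
      ≈⟨ ratio-of-quotients (*-≉0 (poch≉0 b₁ n (λ i _ → b₁+i≉0 i)) (poch≉0 b₂ n (λ i _ → b₂+i≉0 i)))
                            (*-≉0 (b₁+i≉0 n) (b₂+i≉0 n)) ⟩
    bracket2 a₁ a₂ b₁ b₂ n * F ∎
    where
    F G : Carrier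
    F = (a₁ + ι n) * (a₂ + ι n)
    G = (b₁ + ι n) * (b₂ + ι n)

  sumTo-+ : ∀ n (f g : ℕ → Carrier) → sumTo n (λ k → f k + g k) ≈ sumTo n f + sumTo n g
  sumTo-+ zero    f g = refl
  sumTo-+ (suc n) f g = trans (+-congʳ (sumTo-+ n f g))
    (solve 4 (λ F G f g → F + G + (f + g) := F + f + (G + g)) refl (sumTo n f) (sumTo n g) (f (suc n)) (g (suc n)))

  sumTo-*ˡ : ∀ n u (f : ℕ → Carrier) → sumTo n (λ k → u * f k) ≈ u * sumTo n f
  sumTo-*ˡ zero    u f = refl
  sumTo-*ˡ (suc n) u f = trans (+-congʳ (sumTo-*ˡ n u f)) (sym (distribˡ u _ _))

  sumTo-linear₃ : ∀ n u v w (f g h : ℕ → Carrier) →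
    sumTo n (λ k → u * f k + v * g k + w * h k) ≈ u * sumTo n f + v * sumTo n g + w * sumTo n h
  sumTo-linear₃ n u v w f g h = trans (sumTo-+ n _ _)
    (+-cong (trans (sumTo-+ n _ _) (+-cong (sumTo-*ˡ n u f) (sumTo-*ˡ n v g))) (sumTo-*ˡ n w h))

  sumTo-telescoping : ∀ n (f G : ℕ → Carrier) → (∀ k → k ≤ n → f k ≈ G (suc k) - G k) →
    sumTo n f ≈ G (suc n) - G 0
  sumTo-telescoping zero    f G f≈ΔG = f≈ΔG 0 z≤n
  sumTo-telescoping (suc n) f G f≈ΔG = begin
    sumTo n f + f (suc n)                       ≈⟨ +-cong (sumTo-telescoping n f G (λ k k≤n → f≈ΔG k (ℕ.m≤n⇒m≤1+n k≤n)))
                                                          (f≈ΔG (suc n) ℕ.≤-refl) ⟩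
    (G (suc n) - G 0) + (G (suc (suc n)) - G (suc n))
                                                ≈⟨ solve 3 (λ G₀ G₁ G₂ → (G₁ - G₀) + (G₂ - G₁) := G₂ - G₀) refl
                                                          (G 0) (G (suc n)) (G (suc (suc n))) ⟩
    G (suc (suc n)) - G 0                       ∎

  sumTo-pad : ∀ n (f : ℕ → Carrier) → (∀ k → n < k → f k ≈ 0#) → ∀ l → sumTo (l ℕ.+ n) f ≈ sumTo n f
  sumTo-pad n f f≈0 zero    = refl
  sumTo-pad n f f≈0 (suc l) = begin
    sumTo (l ℕ.+ n) f + f (suc (l ℕ.+ n))       ≈⟨ +-cong (sumTo-pad n f f≈0 l) (f≈0 _ (s≤s (ℕ.m≤n+m n l))) ⟩
    sumTo n f + 0#                              ≈⟨ +-identityʳ _ ⟩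
    sumTo n f                                   ∎

  same-ratio⇒≈ : ∀ (y w P Q : ℕ → Carrier) b → (∀ k → k < b → Q k ≉ 0#) →
    (∀ k → k < b → y (suc k) * Q k ≈ y k * P k) → (∀ k → k < b → w (suc k) * Q k ≈ w k * P k) →
    y 0 ≈ w 0 → ∀ k → k ≤ b → y k ≈ w k
  same-ratio⇒≈ y w P Q b Q≉0 y-ratio w-ratio y₀≈w₀ zero    _   = y₀≈w₀
  same-ratio⇒≈ y w P Q b Q≉0 y-ratio w-ratio y₀≈w₀ (suc k) k<b = *-cancelʳ (Q≉0 k k<b) (begin
    y (suc k) * Q k     ≈⟨ y-ratio k k<b ⟩
    y k * P k           ≈⟨ *-congʳ (same-ratio⇒≈ y w P Q b Q≉0 y-ratio w-ratio y₀≈w₀ k (ℕ.<⇒≤ k<b)) ⟩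
    w k * P k           ≈⟨ w-ratio k k<b ⟨
    w (suc k) * Q k     ∎)

  hypergeometric-product : ∀ (y f g : ℕ → Carrier) → y 0 ≈ 1# → ∀ k →
    (∀ i → i < k → y (suc i) * g i ≈ y i * f i) → y k * product< k g ≈ product< k f
  hypergeometric-product y f g y₀≈1 zero    y-ratio = trans (*-identityʳ _) y₀≈1
  hypergeometric-product y f g y₀≈1 (suc k) y-ratio = begin
    y (suc k) * (product< k g * g k)   ≈⟨ solve 3 (λ y Π g → y * (Π * g) := y * g * Π) refl (y (suc k)) (product< k g) (g k) ⟩
    y (suc k) * g k * product< k g     ≈⟨ *-congʳ (y-ratio k ℕ.≤-refl) ⟩
    y k * f k * product< k g           ≈⟨ solve 3 (λ y f Π → y * f * Π := y * Π * f) refl (y k) (f k) (product< k g) ⟩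
    y k * product< k g * f k           ≈⟨ *-congʳ (hypergeometric-product y f g y₀≈1 k (λ i i<k → y-ratio i (ℕ.m<n⇒m<1+n i<k))) ⟩
    product< k f * f k                 ∎

  Recurrence₂ : (c₀ c₁ c₂ s : ℕ → Carrier) → Set ℓ
  Recurrence₂ c₀ c₁ c₂ s = ∀ m → c₀ m * s m + c₁ m * s (suc m) + c₂ m * s (suc (suc m)) ≈ 0#

  recurrence-unique : ∀ {c₀ c₁ c₂ s r} → (∀ m → c₂ m ≉ 0#) →
    Recurrence₂ c₀ c₁ c₂ s → Recurrence₂ c₀ c₁ c₂ r → s 0 ≈ r 0 → s 1 ≈ r 1 → ∀ m → s m ≈ r m
  recurrence-unique {c₀} {c₁} {c₂} {s} {r} c₂≉0 s-rec r-rec s₀≈r₀ s₁≈r₁ m = proj₁ (agree m)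
    where
    agree : ∀ m → s m ≈ r m × s (suc m) ≈ r (suc m)
    agree zero    = s₀≈r₀ , s₁≈r₁
    agree (suc m) with agree m
    ... | sₘ≈rₘ , sₘ₊₁≈rₘ₊₁ = sₘ₊₁≈rₘ₊₁ , *-cancelˡ (c₂≉0 m) (begin
      c₂ m * s (suc (suc m))                       ≈⟨ +-inverseʳ-unique _ _ (s-rec m) ⟩
      - (c₀ m * s m + c₁ m * s (suc m))            ≈⟨ -‿cong (+-cong (*-congˡ sₘ≈rₘ) (*-congˡ sₘ₊₁≈rₘ₊₁)) ⟩
      - (c₀ m * r m + c₁ m * r (suc m))            ≈⟨ +-inverseʳ-unique _ _ (r-rec m) ⟨
      c₂ m * r (suc (suc m))                       ∎)

  Recurrence₂-linear : ∀ {c₀ c₁ c₂ s r} u v → Recurrence₂ c₀ c₁ c₂ s → Recurrence₂ c₀ c₁ c₂ r →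
    Recurrence₂ c₀ c₁ c₂ (λ k → u * s k + v * r k)
  Recurrence₂-linear {c₀} {c₁} {c₂} {s} {r} u v s-rec r-rec m = begin
    c₀ m * (u * s m + v * r m) + c₁ m * (u * s (suc m) + v * r (suc m)) + c₂ m * (u * s (suc (suc m)) + v * r (suc (suc m)))
      ≈⟨ solve 11 (λ c₀ c₁ c₂ u v s₀ s₁ s₂ r₀ r₁ r₂ →
                    c₀ * (u * s₀ + v * r₀) + c₁ * (u * s₁ + v * r₁) + c₂ * (u * s₂ + v * r₂)
                    := u * (c₀ * s₀ + c₁ * s₁ + c₂ * s₂) + v * (c₀ * r₀ + c₁ * r₁ + c₂ * r₂))
               refl (c₀ m) (c₁ m) (c₂ m) u v (s m) (s (suc m)) (s (suc (suc m))) (r m) (r (suc m)) (r (suc (suc m))) ⟩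
    u * (c₀ m * s m + c₁ m * s (suc m) + c₂ m * s (suc (suc m))) + v * (c₀ m * r m + c₁ m * r (suc m) + c₂ m * r (suc (suc m)))
      ≈⟨ +-cong (*-congˡ (s-rec m)) (*-congˡ (r-rec m)) ⟩
    u * 0# + v * 0#
      ≈⟨ solve 2 (λ u v → u * 0# + v * 0# := 0#) refl u v ⟩
    0# ∎

  first-order⇒Recurrence₂ : ∀ (y f g : ℕ → Carrier) (c₀ c₁ c₂ : ℕ → Carrier) →
    (∀ k → g k ≉ 0#) → (∀ k → y (suc k) * g k ≈ y k * f k) →
    (∀ m → c₀ m * g m * g (suc m) + (c₁ m * g (suc m) + c₂ m * f (suc m)) * f m ≈ 0#) →
    Recurrence₂ c₀ c₁ c₂ y
  first-order⇒Recurrence₂ y f g c₀ c₁ c₂ g≉0 y-ratio identity m = *-cancelʳ (*-≉0 (g≉0 m) (g≉0 (suc m))) (begin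
    (c₀ m * y₀ + c₁ m * y₁ + c₂ m * y₂) * (g₀ * g₁)
      ≈⟨ solve 8 (λ c₀ c₁ c₂ y₀ y₁ y₂ g₀ g₁ → (c₀ * y₀ + c₁ * y₁ + c₂ * y₂) * (g₀ * g₁)
                   := c₀ * g₀ * g₁ * y₀ + c₁ * g₁ * (y₁ * g₀) + c₂ * g₀ * (y₂ * g₁))
               refl (c₀ m) (c₁ m) (c₂ m) y₀ y₁ y₂ g₀ g₁ ⟩
    c₀ m * g₀ * g₁ * y₀ + c₁ m * g₁ * (y₁ * g₀) + c₂ m * g₀ * (y₂ * g₁)
      ≈⟨ +-congˡ (*-congˡ (y-ratio (suc m))) ⟩
    c₀ m * g₀ * g₁ * y₀ + c₁ m * g₁ * (y₁ * g₀) + c₂ m * g₀ * (y₁ * f₁)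
      ≈⟨ solve 8 (λ c₀ c₁ c₂ y₀ y₁ g₀ g₁ f₁ → c₀ * g₀ * g₁ * y₀ + c₁ * g₁ * (y₁ * g₀) + c₂ * g₀ * (y₁ * f₁)
                   := y₀ * (c₀ * g₀ * g₁) + (c₁ * g₁ + c₂ * f₁) * (y₁ * g₀))
               refl (c₀ m) (c₁ m) (c₂ m) y₀ y₁ g₀ g₁ f₁ ⟩
    y₀ * (c₀ m * g₀ * g₁) + (c₁ m * g₁ + c₂ m * f₁) * (y₁ * g₀)
      ≈⟨ +-congˡ (*-congˡ (y-ratio m)) ⟩
    y₀ * (c₀ m * g₀ * g₁) + (c₁ m * g₁ + c₂ m * f₁) * (y₀ * f₀)
      ≈⟨ solve 4 (λ y₀ u v f₀ → y₀ * u + v * (y₀ * f₀) := y₀ * (u + v * f₀))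
               refl y₀ (c₀ m * g₀ * g₁) (c₁ m * g₁ + c₂ m * f₁) f₀ ⟩
    y₀ * (c₀ m * g₀ * g₁ + (c₁ m * g₁ + c₂ m * f₁) * f₀)
      ≈⟨ *-congˡ (identity m) ⟩
    y₀ * 0#
      ≈⟨ zeroʳ y₀ ⟩
    0#
      ≈⟨ zeroˡ _ ⟨
    0# * (g₀ * g₁) ∎)
    where
    y₀ y₁ y₂ g₀ g₁ f₀ f₁ : Carrier
    y₀ = y m
    y₁ = y (suc m)
    y₂ = y (suc (suc m))
    g₀ = g m
    g₁ = g (suc m)
    f₀ = f m
    f₁ = f (suc m)

  termNum-diagonal : ∀ (X J : Carrier) → termNum X J J ≈ 0#
  termNum-diagonal = solve 2 (λ X J → termNum X J J := 0#) refl

  R-at-0 : ∀ (X N : Carrier) → R X N 0# ≈ 0#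
  R-at-0 = solve 2 (λ X N → R X N 0# := 0#) refl

  telescoping-certificate : ∀ (X N K : Carrier) →
    termNum X (1# + (1# + N)) K * R X N (1# + K) ≈ termDen N K * (R X N K + P X N K)
  telescoping-certificate = solve 3 (λ X N K →
    termNum X (1# + (1# + N)) K * R X N (1# + K) := termDen N K * (R X N K + P X N K)) refl

  p₀-shift : ∀ (X N K : Carrier) →
    termNum X (1# + (1# + N)) K * termDen N K * p₀ N (1# + K) ≈ p₀ N K * (termNum X N K * termDen N K)
  p₀-shift = solve 3 (λ X N K →
    termNum X (1# + (1# + N)) K * termDen N K * p₀ N (1# + K) := p₀ N K * (termNum X N K * termDen N K)) refl

  p₁-shift : ∀ (X N K : Carrier) →
    termNum X (1# + (1# + N)) K * termDen (1# + N) K * p₁ N (1# + K) ≈ p₁ N K * (termNum X (1# + N) K * termDen N K)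
  p₁-shift = solve 3 (λ X N K →
    termNum X (1# + (1# + N)) K * termDen (1# + N) K * p₁ N (1# + K) := p₁ N K * (termNum X (1# + N) K * termDen N K)) refl

  p₂-shift : ∀ (X N K : Carrier) →
    termNum X (1# + (1# + N)) K * termDen (1# + (1# + N)) K * p₂ N (1# + K)
      ≈ p₂ N K * (termNum X (1# + (1# + N)) K * termDen N K)
  p₂-shift = solve 3 (λ X N K →
    termNum X (1# + (1# + N)) K * termDen (1# + (1# + N)) K * p₂ N (1# + K)
      := p₂ N K * (termNum X (1# + (1# + N)) K * termDen N K)) refl

  c-via-p : ∀ (X N t₀ t₁ t₂ : Carrier) →
    c₀ X N * t₀ + c₁ X N * t₁ + c₂ N * t₂ ≈ e₀ X N * (t₀ * p₀ N 0#) + e₁ X N * (t₁ * p₁ N 0#) + t₂ * p₂ N 0#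
  c-via-p = solve 5 (λ X N t₀ t₁ t₂ →
    c₀ X N * t₀ + c₁ X N * t₁ + c₂ N * t₂ := e₀ X N * (t₀ * p₀ N 0#) + e₁ X N * (t₁ * p₁ N 0#) + t₂ * p₂ N 0#) refl

  bracket₁-recurrence : ∀ (X N : Carrier) →
    c₀ X N * bracketDen N * bracketDen (1# + N) + (c₁ X N * bracketDen (1# + N) + c₂ N * bracketNum₁ X (1# + N)) * bracketNum₁ X N ≈ 0#
  bracket₁-recurrence = solve 2 (λ X N →
    c₀ X N * bracketDen N * bracketDen (1# + N) + (c₁ X N * bracketDen (1# + N) + c₂ N * bracketNum₁ X (1# + N)) * bracketNum₁ X N := 0#) refl

  bracket₂-recurrence : ∀ (X N : Carrier) →
    c₀ X N * bracketDen N * bracketDen (1# + N) + (c₁ X N * bracketDen (1# + N) + c₂ N * bracketNum₂ X (1# + N)) * bracketNum₂ X N ≈ 0#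
  bracket₂-recurrence = solve 2 (λ X N →
    c₀ X N * bracketDen N * bracketDen (1# + N) + (c₁ X N * bracketDen (1# + N) + c₂ N * bracketNum₂ X (1# + N)) * bracketNum₂ X N := 0#) refl

  initial-value-1 : ∀ (X : Carrier) →
    let g = λ i → termDen (ι 1) (ι i); f = λ i → termNum X (ι 1) (ι i); h = λ i → bracketDen (ι i) in
    (1# * product< 1 g + product< 1 f) * product< 1 h * (ι 6 * X - 1#)
      ≈ product< 1 g * (ι 3 * X * product< 1 (λ i → bracketNum₁ X (ι i)) + (ι 3 * X - 1#) * product< 1 (λ i → bracketNum₂ X (ι i)))
  initial-value-1 = solve 1 (λ X →
    let g = λ i → termDen (ι 1) (ι i); f = λ i → termNum X (ι 1) (ι i); h = λ i → bracketDen (ι i) in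
    (1# * product< 1 g + product< 1 f) * product< 1 h * (ι 6 * X - 1#)
      := product< 1 g * (ι 3 * X * product< 1 (λ i → bracketNum₁ X (ι i)) + (ι 3 * X - 1#) * product< 1 (λ i → bracketNum₂ X (ι i)))) refl

  initial-value-2 : ∀ (X : Carrier) →
    let g = λ i → termDen (ι 2) (ι i); f = λ i → termNum X (ι 2) (ι i); h = λ i → bracketDen (ι i) in
    (1# * product< 2 g + product< 1 f * g 1 + product< 2 f) * product< 2 h * (ι 6 * X - 1#)
      ≈ product< 2 g * (ι 3 * X * product< 2 (λ i → bracketNum₁ X (ι i)) + (ι 3 * X - 1#) * product< 2 (λ i → bracketNum₂ X (ι i)))
  initial-value-2 = solve 1 (λ X →
    let g = λ i → termDen (ι 2) (ι i); f = λ i → termNum X (ι 2) (ι i); h = λ i → bracketDen (ι i) in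
    (1# * product< 2 g + product< 1 f * g 1 + product< 2 f) * product< 2 h * (ι 6 * X - 1#)
      := product< 2 g * (ι 3 * X * product< 2 (λ i → bracketNum₁ X (ι i)) + (ι 3 * X - 1#) * product< 2 (λ i → bracketNum₂ X (ι i)))) refl

  module _ (x : Carrier) where
    a b d z t₂ t₄ : Carrier
    a  = ι 3 * x
    b  = 1# - ι 3 * x
    d  = ι 3 / ι 2
    z  = ι 3 / ι 4
    t₂ = ι 2 / ι 3
    t₄ = ι 4 / ι 3

    e : ℕ → Carrier
    e j = - (1# + ι 3 * ι j)

    term : ℕ → ℕ → Carrier
    term j k = (poch a k * poch b k * poch (- ι j) k) * (z ^ k) / (ι (k ℕ.!) * poch d k * poch (e j) k)

    S : ℕ → Carrier
    S n = F32 a b n d (e n) z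

    A B : ℕ → Carrier
    A = bracket2 (1# + x) (1# - x) t₂ t₄
    B = bracket2 (t₂ + x) (t₄ - x) t₂ t₄

    A-at-0 : A 0 ≈ 1#
    A-at-0 = bracket2-at-0 (1# + x) (1# - x) t₂ t₄

    B-at-0 : B 0 ≈ 1#
    B-at-0 = bracket2-at-0 (t₂ + x) (t₄ - x) t₂ t₄

    d+ι≉0 : ∀ i → d + ι i ≉ 0#
    d+ι≉0 = shift≉0 2 2 (/-*-cancel (charZero 1))

    t₂+ι≉0 : ∀ i → t₂ + ι i ≉ 0#
    t₂+ι≉0 = shift≉0 3 1 (/-*-cancel (charZero 2))

    t₄+ι≉0 : ∀ i → t₄ + ι i ≉ 0#
    t₄+ι≉0 = shift≉0 3 3 (/-*-cancel (charZero 2))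

    e+ι≈ : ∀ j i → i ≤ 3 ℕ.* j → e j + ι i ≈ - (1# + ι (3 ℕ.* j ℕ.∸ i))
    e+ι≈ j i i≤3j = begin
      - (1# + ι 3 * ι j) + ι i                    ≈⟨ +-congʳ (-‿cong (+-congˡ (ι-homo-* 3 j))) ⟨
      - (1# + ι (3 ℕ.* j)) + ι i                  ≡⟨ ≡.cong (λ n → - (1# + ι n) + ι i) (ℕ.m+[n∸m]≡n i≤3j) ⟨
      - (1# + ι (i ℕ.+ (3 ℕ.* j ℕ.∸ i))) + ι i    ≈⟨ +-congʳ (-‿cong (+-congˡ (ι-homo-+ i _))) ⟩
      - (1# + (ι i + ι (3 ℕ.* j ℕ.∸ i))) + ι i    ≈⟨ solve 2 (λ I T → - (1# + (I + T)) + I := - (1# + T)) refl (ι i) _ ⟩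
      - (1# + ι (3 ℕ.* j ℕ.∸ i))                  ∎

    e+ι≉0 : ∀ j i → i ≤ 3 ℕ.* j → e j + ι i ≉ 0#
    e+ι≉0 j i i≤3j = ≉0-cong (sym (e+ι≈ j i i≤3j)) (-‿≉0 (charZero (3 ℕ.* j ℕ.∸ i)))

    term-at-0 : ∀ j → term j 0 ≈ 1#
    term-at-0 j = begin
      1# * 1# * 1# * 1# * (ι 1 * 1# * 1#) ⁻¹     ≈⟨ *-cong (solve 0 (1# * 1# * 1# * 1# := 1#) refl)
                                                          (trans (⁻¹-cong (solve 0 (ι 1 * 1# * 1# := 1#) refl)) 1⁻¹≈1) ⟩
      1# * 1#                                   ≈⟨ *-identityˡ 1# ⟩
      1#                                        ∎

    term-vanishes : ∀ j k → j < k → term j k ≈ 0#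
    term-vanishes j k j<k = begin
      poch a k * poch b k * poch (- ι j) k * z ^ k * D ⁻¹   ≈⟨ *-congʳ (*-congʳ (*-congˡ (poch-neg-vanishes j k j<k))) ⟩
      poch a k * poch b k * 0# * z ^ k * D ⁻¹              ≈⟨ solve 4 (λ u v w y → u * v * 0# * w * y := 0#) refl _ _ _ _ ⟩
      0#                                                   ∎
      where
      D : Carrier
      D = ι (k ℕ.!) * poch d k * poch (e j) k

    termNum-as-ratio : ∀ J K → termNum x J K ≈ ι 4 * ((a + K) * (b + K) * (- J + K) * z)
    termNum-as-ratio J K = begin
      ι 3 * (a + K) * (b + K) * (K - J)           ≈⟨ *-congʳ (*-congʳ (*-congʳ (/-*-cancel (charZero 3)))) ⟨
      z * ι 4 * (a + K) * (b + K) * (K - J)       ≈⟨ solve 5 (λ z a b J K → z * ι 4 * (a + K) * (b + K) * (K - J)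
                                                                       := ι 4 * ((a + K) * (b + K) * (- J + K) * z)) refl z a b J K ⟩
      ι 4 * ((a + K) * (b + K) * (- J + K) * z)   ∎

    termDen-as-ratio : ∀ J K → termDen J K ≈ ι 4 * ((1# + K) * (d + K) * (- (1# + ι 3 * J) + K))
    termDen-as-ratio J K = begin
      ι 2 * (1# + K) * (ι 2 * K + ι 3) * (K - (1# + ι 3 * J))       ≈⟨ *-congʳ (*-congˡ (+-congˡ (/-*-cancel (charZero 1)))) ⟨
      ι 2 * (1# + K) * (ι 2 * K + d * ι 2) * (K - (1# + ι 3 * J))   ≈⟨ solve 3 (λ d J K → ι 2 * (1# + K) * (ι 2 * K + d * ι 2) * (K - (1# + ι 3 * J))
                                                                        := ι 4 * ((1# + K) * (d + K) * (- (1# + ι 3 * J) + K))) refl d J K ⟩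
      ι 4 * ((1# + K) * (d + K) * (- (1# + ι 3 * J) + K))           ∎

    ratioDen≉0 : ∀ j k → k ≤ 3 ℕ.* j → (1# + ι k) * (d + ι k) * (e j + ι k) ≉ 0#
    ratioDen≉0 j k k≤3j = *-≉0 (*-≉0 (charZero k) (d+ι≉0 k)) (e+ι≉0 j k k≤3j)

    termDen≉0 : ∀ j k → k ≤ 3 ℕ.* j → termDen (ι j) (ι k) ≉ 0#
    termDen≉0 j k k≤3j = ≉0-cong (sym (termDen-as-ratio (ι j) (ι k))) (*-≉0 (charZero 3) (ratioDen≉0 j k k≤3j))

    term-step : ∀ j k → k ≤ 3 ℕ.* j →
      term j (suc k) * ((1# + ι k) * (d + ι k) * (e j + ι k)) ≈ term j k * ((a + ι k) * (b + ι k) * (- ι j + ι k) * z)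
    term-step j k k≤3j = begin
      (Pa * (a + K) * (Pb * (b + K)) * (Pc * (- J + K))) * (z * zᵏ) / (ι (suc k ℕ.!) * (Pd * (d + K)) * (Pe * (e j + K))) * G
        ≈⟨ *-congʳ (*-cong numerator (⁻¹-cong denominator)) ⟩
      (Pa * Pb * Pc * zᵏ * F) / (ι (k ℕ.!) * Pd * Pe * G) * G
        ≈⟨ ratio-of-quotients D≉0 (ratioDen≉0 j k k≤3j) ⟩
      term j k * F ∎
      where
      J K Pa Pb Pc Pd Pe zᵏ F G : Carrier
      J = ι j
      K = ι k
      Pa = poch a k
      Pb = poch b k
      Pc = poch (- J) k
      Pd = poch d k
      Pe = poch (e j) k
      zᵏ = z ^ k
      F = (a + K) * (b + K) * (- J + K) * z
      G = (1# + K) * (d + K) * (e j + K)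
      numerator : Pa * (a + K) * (Pb * (b + K)) * (Pc * (- J + K)) * (z * zᵏ) ≈ Pa * Pb * Pc * zᵏ * F
      numerator = solve 8 (λ Pa Pb Pc zᵏ a′ b′ c′ z → Pa * a′ * (Pb * b′) * (Pc * c′) * (z * zᵏ)
                                                     := Pa * Pb * Pc * zᵏ * (a′ * b′ * c′ * z))
                    refl Pa Pb Pc zᵏ (a + K) (b + K) (- J + K) z
      denominator : ι (suc k ℕ.!) * (Pd * (d + K)) * (Pe * (e j + K)) ≈ ι (k ℕ.!) * Pd * Pe * G
      denominator = trans (*-congʳ (*-congʳ (ι-homo-* (suc k) (k ℕ.!))))
        (solve 6 (λ s f Pd d′ Pe e′ → s * f * (Pd * d′) * (Pe * e′) := f * Pd * Pe * (s * d′ * e′))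
           refl (1# + K) (ι (k ℕ.!)) Pd (d + K) Pe (e j + K))
      D≉0 : ι (k ℕ.!) * Pd * Pe ≉ 0#
      D≉0 = *-≉0 (*-≉0 (!≉0 k) (poch≉0 d k (λ i _ → d+ι≉0 i)))
                 (poch≉0 (e j) k (λ i i<k → e+ι≉0 j i (ℕ.≤-trans (ℕ.<⇒≤ i<k) k≤3j)))

    term-ratio : ∀ j k → k ≤ 3 ℕ.* j → term j (suc k) * termDen (ι j) (ι k) ≈ term j k * termNum x (ι j) (ι k)
    term-ratio j k k≤3j = begin
      term j (suc k) * termDen (ι j) (ι k)                                     ≈⟨ *-congˡ (termDen-as-ratio (ι j) (ι k)) ⟩
      term j (suc k) * (ι 4 * ((1# + ι k) * (d + ι k) * (e j + ι k)))          ≈⟨ ratio-scale (ι 4) (term-step j k k≤3j) ⟩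
      term j k * (ι 4 * ((a + ι k) * (b + ι k) * (- ι j + ι k) * z))           ≈⟨ *-congˡ (termNum-as-ratio (ι j) (ι k)) ⟨
      term j k * termNum x (ι j) (ι k)                                         ∎

    term-product : ∀ j k → k ≤ j →
      term j k * product< k (λ i → termDen (ι j) (ι i)) ≈ product< k (λ i → termNum x (ι j) (ι i))
    term-product j k k≤j = hypergeometric-product (term j) _ _ (term-at-0 j) k
      (λ i i<k → term-ratio j i (ℕ.≤-trans (ℕ.<⇒≤ (ℕ.<-≤-trans i<k k≤j)) (ℕ.m≤n*m j 3)))

    bracketDen≉0 : ∀ n → bracketDen (ι n) ≉ 0#
    bracketDen≉0 n = *-≉0 (ι-affine≉0 3 n 1) (ι-affine≉0 3 n 3)

    bracketDen-as-ratio : ∀ N → bracketDen N ≈ ι 9 * ((t₂ + N) * (t₄ + N))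
    bracketDen-as-ratio N = begin
      (ι 3 * N + ι 2) * (ι 3 * N + ι 4)               ≈⟨ *-cong (+-congˡ (/-*-cancel (charZero 2))) (+-congˡ (/-*-cancel (charZero 2))) ⟨
      (ι 3 * N + t₂ * ι 3) * (ι 3 * N + t₄ * ι 3)     ≈⟨ solve 3 (λ t₂ t₄ N → (ι 3 * N + t₂ * ι 3) * (ι 3 * N + t₄ * ι 3)
                                                                     := ι 9 * ((t₂ + N) * (t₄ + N))) refl t₂ t₄ N ⟩
      ι 9 * ((t₂ + N) * (t₄ + N))                     ∎

    bracketNum₂-as-ratio : ∀ N → bracketNum₂ x N ≈ ι 9 * ((t₂ + x + N) * (t₄ - x + N))
    bracketNum₂-as-ratio N = begin
      (ι 3 * N + ι 2 + ι 3 * x) * (ι 3 * N + ι 4 - ι 3 * x)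
        ≈⟨ *-cong (+-congʳ (+-congˡ (/-*-cancel (charZero 2)))) (+-congʳ (+-congˡ (/-*-cancel (charZero 2)))) ⟨
      (ι 3 * N + t₂ * ι 3 + ι 3 * x) * (ι 3 * N + t₄ * ι 3 - ι 3 * x)
        ≈⟨ solve 4 (λ t₂ t₄ x N → (ι 3 * N + t₂ * ι 3 + ι 3 * x) * (ι 3 * N + t₄ * ι 3 - ι 3 * x)
                                  := ι 9 * ((t₂ + x + N) * (t₄ - x + N))) refl t₂ t₄ x N ⟩
      ι 9 * ((t₂ + x + N) * (t₄ - x + N)) ∎

    A-ratio : ∀ n → A (suc n) * bracketDen (ι n) ≈ A n * bracketNum₁ x (ι n)
    A-ratio n = trans (*-congˡ (bracketDen-as-ratio (ι n)))
      (ratio-scale (ι 9) (bracket2-ratio (1# + x) (1# - x) t₂ t₄ t₂+ι≉0 t₄+ι≉0 n))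

    B-ratio : ∀ n → B (suc n) * bracketDen (ι n) ≈ B n * bracketNum₂ x (ι n)
    B-ratio n = trans (*-congˡ (bracketDen-as-ratio (ι n)))
      (trans (ratio-scale (ι 9) (bracket2-ratio (t₂ + x) (t₄ - x) t₂ t₄ t₂+ι≉0 t₄+ι≉0 n))
             (*-congˡ (sym (bracketNum₂-as-ratio (ι n)))))

    -- Creative telescoping for n = suc m: for n = 0 the denominators termDen 0 k vanish at k = 1.
    module Telescoping (m : ℕ) where
      n : ℕ
      n = suc m

      N : Carrier
      N = ι n

      k≤n+2⇒k≤3j : ∀ {j k} → n ≤ j → k ≤ suc (suc n) → k ≤ 3 ℕ.* j
      k≤n+2⇒k≤3j n≤j k≤n+2 = ℕ.≤-trans k≤n+2 (ℕ.≤-trans n+2≤3n (ℕ.*-monoʳ-≤ 3 n≤j))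
        where
        n+2≤3n : suc (suc n) ≤ 3 ℕ.* n
        n+2≤3n = ℕ.≤-trans (ℕ.+-monoʳ-≤ 3 (ℕ.m≤n*m m 3)) (ℕ.≤-reflexive (≡.sym (ℕ.*-suc 3 m)))

      V : ℕ → Carrier
      V zero    = 1#
      V (suc k) = V k * termNum x (ι (suc (suc n))) (ι k) / termDen N (ι k)

      V-ratio : ∀ k → k ≤ suc (suc n) → V (suc k) * termDen N (ι k) ≈ V k * termNum x (ι (suc (suc n))) (ι k)
      V-ratio k k≤n+2 = /-*-cancel (termDen≉0 n k (k≤n+2⇒k≤3j ℕ.≤-refl k≤n+2))

      term-via-V : ∀ j (p : Carrier → Carrier) → n ≤ j →
        (∀ K → termNum x (ι (suc (suc n))) K * termDen (ι j) K * p (1# + K) ≈ p K * (termNum x (ι j) K * termDen N K)) →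
        ∀ k → k ≤ suc (suc n) → term j k * p 0# ≈ V k * p (ι k)
      term-via-V j p n≤j p-shift = same-ratio⇒≈ y w f g (suc (suc n)) g≉0 y-ratio w-ratio (*-congʳ (term-at-0 j))
        where
        y w f g : ℕ → Carrier
        y k = term j k * p 0#
        w k = V k * p (ι k)
        f k = termNum x (ι j) (ι k) * termDen N (ι k)
        g k = termDen (ι j) (ι k) * termDen N (ι k)

        g≉0 : ∀ k → k < suc (suc n) → g k ≉ 0#
        g≉0 k k<n+2 = *-≉0 (termDen≉0 j k (k≤n+2⇒k≤3j n≤j (ℕ.<⇒≤ k<n+2))) (termDen≉0 n k (k≤n+2⇒k≤3j ℕ.≤-refl (ℕ.<⇒≤ k<n+2)))

        y-ratio : ∀ k → k < suc (suc n) → y (suc k) * g k ≈ y k * f k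
        y-ratio k k<n+2 = begin
          term j (suc k) * p 0# * (gⱼ * gₙ)    ≈⟨ solve 4 (λ t p gⱼ gₙ → t * p * (gⱼ * gₙ) := t * gⱼ * (p * gₙ)) refl _ _ _ _ ⟩
          term j (suc k) * gⱼ * (p 0# * gₙ)    ≈⟨ *-congʳ (term-ratio j k (k≤n+2⇒k≤3j n≤j (ℕ.<⇒≤ k<n+2))) ⟩
          term j k * fⱼ * (p 0# * gₙ)          ≈⟨ solve 4 (λ t f p gₙ → t * f * (p * gₙ) := t * p * (f * gₙ)) refl _ _ _ _ ⟩
          term j k * p 0# * (fⱼ * gₙ)          ∎
          where
          fⱼ gⱼ gₙ : Carrier
          fⱼ = termNum x (ι j) (ι k)
          gⱼ = termDen (ι j) (ι k)
          gₙ = termDen N (ι k)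

        w-ratio : ∀ k → k < suc (suc n) → w (suc k) * g k ≈ w k * f k
        w-ratio k k<n+2 = begin
          V (suc k) * p (1# + K) * (gⱼ * gₙ)    ≈⟨ solve 4 (λ v p gⱼ gₙ → v * p * (gⱼ * gₙ) := v * gₙ * (p * gⱼ)) refl _ _ _ _ ⟩
          V (suc k) * gₙ * (p (1# + K) * gⱼ)    ≈⟨ *-congʳ (V-ratio k (ℕ.<⇒≤ k<n+2)) ⟩
          V k * f₂ * (p (1# + K) * gⱼ)          ≈⟨ solve 4 (λ v f p gⱼ → v * f * (p * gⱼ) := v * (f * gⱼ * p)) refl _ _ _ _ ⟩
          V k * (f₂ * gⱼ * p (1# + K))          ≈⟨ *-congˡ (p-shift K) ⟩
          V k * (p K * (fⱼ * gₙ))               ≈⟨ *-assoc _ _ _ ⟨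
          V k * p K * (fⱼ * gₙ)                 ∎
          where
          K f₂ fⱼ gⱼ gₙ : Carrier
          K = ι k
          f₂ = termNum x (ι (suc (suc n))) K
          fⱼ = termNum x (ι j) K
          gⱼ = termDen (ι j) K
          gₙ = termDen N K

      T : ℕ → Carrier
      T k = c₀ x N * term n k + c₁ x N * term (suc n) k + c₂ N * term (suc (suc n)) k

      T≈VP : ∀ k → k ≤ suc (suc n) → T k ≈ V k * P x N (ι k)
      T≈VP k k≤n+2 = begin
        c₀ x N * τ₀ + c₁ x N * τ₁ + c₂ N * τ₂
          ≈⟨ c-via-p x N τ₀ τ₁ τ₂ ⟩
        e₀ x N * (τ₀ * p₀ N 0#) + e₁ x N * (τ₁ * p₁ N 0#) + τ₂ * p₂ N 0#
          ≈⟨ +-cong (+-cong (*-congˡ (term-via-V n (p₀ N) ℕ.≤-refl (p₀-shift x N) k k≤n+2))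
                            (*-congˡ (term-via-V (suc n) (p₁ N) (ℕ.n≤1+n n) (p₁-shift x N) k k≤n+2)))
                    (term-via-V (suc (suc n)) (p₂ N) (ℕ.m≤n+m n 2) (p₂-shift x N) k k≤n+2) ⟩
        e₀ x N * (V k * p₀ N K) + e₁ x N * (V k * p₁ N K) + V k * p₂ N K
          ≈⟨ solve 6 (λ e₀ e₁ v q₀ q₁ q₂ → e₀ * (v * q₀) + e₁ * (v * q₁) + v * q₂ := v * (e₀ * q₀ + e₁ * q₁ + q₂))
               refl (e₀ x N) (e₁ x N) (V k) (p₀ N K) (p₁ N K) (p₂ N K) ⟩
        V k * P x N K ∎
        where
        K τ₀ τ₁ τ₂ : Carrier
        K = ι k
        τ₀ = term n k
        τ₁ = term (suc n) k
        τ₂ = term (suc (suc n)) k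

      G : ℕ → Carrier
      G k = V k * R x N (ι k)

      V-R-step : ∀ k → k ≤ suc (suc n) → V (suc k) * R x N (1# + ι k) ≈ V k * (R x N (ι k) + P x N (ι k))
      V-R-step k k≤n+2 = *-cancelʳ (termDen≉0 n k (k≤n+2⇒k≤3j ℕ.≤-refl k≤n+2)) (begin
        V (suc k) * R′ * gₙ              ≈⟨ solve 3 (λ v r g → v * r * g := v * g * r) refl (V (suc k)) R′ gₙ ⟩
        V (suc k) * gₙ * R′              ≈⟨ *-congʳ (V-ratio k k≤n+2) ⟩
        V k * termNum x (ι (suc (suc n))) K * R′
                                         ≈⟨ *-assoc _ _ _ ⟩
        V k * (termNum x (ι (suc (suc n))) K * R′)
                                         ≈⟨ *-congˡ (telescoping-certificate x N K) ⟩
        V k * (gₙ * (R x N K + P x N K)) ≈⟨ solve 3 (λ v g r → v * (g * r) := v * r * g) refl (V k) gₙ _ ⟩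
        V k * (R x N K + P x N K) * gₙ   ∎)
        where
        K R′ gₙ : Carrier
        K = ι k
        R′ = R x N (1# + K)
        gₙ = termDen N K

      T≈ΔG : ∀ k → k ≤ suc (suc n) → T k ≈ G (suc k) - G k
      T≈ΔG k k≤n+2 = begin
        T k                                          ≈⟨ T≈VP k k≤n+2 ⟩
        V k * P x N K                                ≈⟨ solve 3 (λ v r p → v * p := v * (r + p) - v * r) refl (V k) (R x N K) (P x N K) ⟩
        V k * (R x N K + P x N K) - V k * R x N K    ≈⟨ +-congʳ (V-R-step k k≤n+2) ⟨
        G (suc k) - G k                              ∎
        where
        K : Carrier
        K = ι k

      G-top : G (suc (suc (suc n))) ≈ 0#
      G-top = begin
        V (suc (suc n)) * termNum x K K / termDen N K * R x N (ι (suc (suc (suc n))))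
          ≈⟨ *-congʳ (*-congʳ (*-congˡ (termNum-diagonal x K))) ⟩
        V (suc (suc n)) * 0# / termDen N K * R x N (ι (suc (suc (suc n))))
          ≈⟨ solve 3 (λ v i r → v * 0# * i * r := 0#) refl _ _ _ ⟩
        0# ∎
        where
        K : Carrier
        K = ι (suc (suc n))

      recurrence : c₀ x N * S n + c₁ x N * S (suc n) + c₂ N * S (suc (suc n)) ≈ 0#
      recurrence = begin
        c₀ x N * S n + c₁ x N * S (suc n) + c₂ N * S (suc (suc n))
          ≈⟨ +-cong (+-cong (*-congˡ (pad n 2)) (*-congˡ (pad (suc n) 1))) (*-congˡ (pad (suc (suc n)) 0)) ⟨
        c₀ x N * sumTo (suc (suc n)) (term n) + c₁ x N * sumTo (suc (suc n)) (term (suc n)) + c₂ N * sumTo (suc (suc n)) (term (suc (suc n)))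
          ≈⟨ sumTo-linear₃ (suc (suc n)) _ _ _ (term n) (term (suc n)) (term (suc (suc n))) ⟨
        sumTo (suc (suc n)) T
          ≈⟨ sumTo-telescoping (suc (suc n)) T G T≈ΔG ⟩
        G (suc (suc (suc n))) - G 0
          ≈⟨ +-cong G-top (-‿cong (trans (*-congˡ (R-at-0 x N)) (zeroʳ 1#))) ⟩
        0# - 0#
          ≈⟨ trans (+-congˡ -0#≈0#) (+-identityʳ 0#) ⟩
        0# ∎
        where
        pad : ∀ j l → sumTo (l ℕ.+ j) (term j) ≈ S j
        pad j = sumTo-pad j (term j) (term-vanishes j)

    module _ (w≉0 : ι 6 * x - 1# ≉ 0#) where
      w α β : Carrier
      w = ι 6 * x - 1#
      α = ι 3 * x / w
      β = (ι 3 * x - 1#) / w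

      rhs : ℕ → Carrier
      rhs n = α * A n + β * B n

      A-recurrence : Recurrence₂ (λ k → c₀ x (ι k)) (λ k → c₁ x (ι k)) (λ k → c₂ (ι k)) A
      A-recurrence = first-order⇒Recurrence₂ A (λ k → bracketNum₁ x (ι k)) (λ k → bracketDen (ι k)) _ _ _
        bracketDen≉0 A-ratio (λ k → bracket₁-recurrence x (ι k))

      B-recurrence : Recurrence₂ (λ k → c₀ x (ι k)) (λ k → c₁ x (ι k)) (λ k → c₂ (ι k)) B
      B-recurrence = first-order⇒Recurrence₂ B (λ k → bracketNum₂ x (ι k)) (λ k → bracketDen (ι k)) _ _ _
        bracketDen≉0 B-ratio (λ k → bracket₂-recurrence x (ι k))

      rhs-recurrence : Recurrence₂ (λ k → c₀ x (ι k)) (λ k → c₁ x (ι k)) (λ k → c₂ (ι k)) rhs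
      rhs-recurrence = Recurrence₂-linear α β A-recurrence B-recurrence

      c₂≉0 : ∀ n → c₂ (ι n) ≉ 0#
      c₂≉0 n = *-≉0 (*-≉0 (*-≉0 (*-≉0 (*-≉0 (ι-affine≉0 3 n 1) (ι-affine≉0 3 n 2)) (ι-affine≉0 3 n 3))
                     (ι-affine≉0 3 n 4)) (ι-affine≉0 3 n 5)) (ι-affine≉0 3 n 6)

      rhs-cleared : ∀ n Π → rhs n * (Π * product< n (λ i → bracketDen (ι i)) * w)
        ≈ Π * (ι 3 * x * product< n (λ i → bracketNum₁ x (ι i)) + (ι 3 * x - 1#) * product< n (λ i → bracketNum₂ x (ι i)))
      rhs-cleared n Π = begin
        (α * A n + β * B n) * (Π * H * w)
          ≈⟨ solve 7 (λ α β A B Π H w → (α * A + β * B) * (Π * H * w) := Π * (α * w * (A * H) + β * w * (B * H)))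
               refl α β (A n) (B n) Π H w ⟩
        Π * (α * w * (A n * H) + β * w * (B n * H))
          ≈⟨ *-congˡ (+-cong (*-cong (/-*-cancel w≉0) (hypergeometric-product A _ _ A-at-0 n (λ i _ → A-ratio i)))
                             (*-cong (/-*-cancel w≉0) (hypergeometric-product B _ _ B-at-0 n (λ i _ → B-ratio i)))) ⟩
        Π * (ι 3 * x * product< n (λ i → bracketNum₁ x (ι i)) + (ι 3 * x - 1#) * product< n (λ i → bracketNum₂ x (ι i))) ∎
        where
        H : Carrier
        H = product< n (λ i → bracketDen (ι i))

      S≈rhs-by-clearing : ∀ n →
        let g = λ i → termDen (ι n) (ι i) in
        S n * (product< n g * product< n (λ i → bracketDen (ι i)) * w)
          ≈ product< n g * (ι 3 * x * product< n (λ i → bracketNum₁ x (ι i)) + (ι 3 * x - 1#) * product< n (λ i → bracketNum₂ x (ι i))) →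
        S n ≈ rhs n
      S≈rhs-by-clearing n cleared = *-cancelʳ D≉0 (trans cleared (sym (rhs-cleared n _)))
        where
        D≉0 : product< n (λ i → termDen (ι n) (ι i)) * product< n (λ i → bracketDen (ι i)) * w ≉ 0#
        D≉0 = *-≉0 (*-≉0 (product<≉0 n _ (λ i i<n → termDen≉0 n i (ℕ.≤-trans (ℕ.<⇒≤ i<n) (ℕ.m≤n*m n 3))))
                         (product<≉0 n _ (λ i _ → bracketDen≉0 i)))
                   w≉0

      S≈rhs-0 : S 0 ≈ rhs 0
      S≈rhs-0 = S≈rhs-by-clearing 0 (trans (*-congʳ (term-at-0 0))
        (solve 1 (λ x → 1# * (1# * 1# * (ι 6 * x - 1#)) := 1# * (ι 3 * x * 1# + (ι 3 * x - 1#) * 1#)) refl x))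

      S≈rhs-1 : S 1 ≈ rhs 1
      S≈rhs-1 = S≈rhs-by-clearing 1 (begin
        (term 1 0 + term 1 1) * (Πg * Πh * w)
          ≈⟨ solve 5 (λ t₀ t₁ Πg Πh w → (t₀ + t₁) * (Πg * Πh * w) := (t₀ * Πg + t₁ * Πg) * Πh * w) refl _ _ _ _ _ ⟩
        (term 1 0 * Πg + term 1 1 * Πg) * Πh * w
          ≈⟨ *-congʳ (*-congʳ (+-cong (*-congʳ (term-at-0 1)) (term-product 1 1 ℕ.≤-refl))) ⟩
        (1# * Πg + product< 1 (λ i → termNum x (ι 1) (ι i))) * Πh * w
          ≈⟨ initial-value-1 x ⟩
        Πg * (ι 3 * x * product< 1 (λ i → bracketNum₁ x (ι i)) + (ι 3 * x - 1#) * product< 1 (λ i → bracketNum₂ x (ι i))) ∎)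
        where
        Πg Πh : Carrier
        Πg = product< 1 (λ i → termDen (ι 1) (ι i))
        Πh = product< 1 (λ i → bracketDen (ι i))

      S≈rhs-2 : S 2 ≈ rhs 2
      S≈rhs-2 = S≈rhs-by-clearing 2 (begin
        (term 2 0 + term 2 1 + term 2 2) * (product< 1 g * g 1 * Πh * w)
          ≈⟨ solve 7 (λ t₀ t₁ t₂ Πg g₁ Πh w → (t₀ + t₁ + t₂) * (Πg * g₁ * Πh * w)
                                               := (t₀ * (Πg * g₁) + t₁ * Πg * g₁ + t₂ * (Πg * g₁)) * Πh * w)
               refl _ _ _ (product< 1 g) (g 1) Πh w ⟩
        (term 2 0 * product< 2 g + term 2 1 * product< 1 g * g 1 + term 2 2 * product< 2 g) * Πh * w
          ≈⟨ *-congʳ (*-congʳ (+-cong (+-cong (*-congʳ (term-at-0 2)) (*-congʳ (term-product 2 1 (ℕ.n≤1+n 1))))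
                                      (term-product 2 2 ℕ.≤-refl))) ⟩
        (1# * product< 2 g + product< 1 f * g 1 + product< 2 f) * Πh * w
          ≈⟨ initial-value-2 x ⟩
        product< 2 g * (ι 3 * x * product< 2 (λ i → bracketNum₁ x (ι i)) + (ι 3 * x - 1#) * product< 2 (λ i → bracketNum₂ x (ι i))) ∎)
        where
        g f : ℕ → Carrier
        g i = termDen (ι 2) (ι i)
        f i = termNum x (ι 2) (ι i)
        Πh : Carrier
        Πh = product< 2 (λ i → bracketDen (ι i))

      S≈rhs : ∀ n → S n ≈ rhs n
      S≈rhs zero    = S≈rhs-0
      S≈rhs (suc m) = recurrence-unique
        {c₀ = λ m → c₀ x (ι (suc m))} {c₁ = λ m → c₁ x (ι (suc m))} {c₂ = λ m → c₂ (ι (suc m))}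
        {s = λ m → S (suc m)} {r = λ m → rhs (suc m)}
        (λ m → c₂≉0 (suc m)) Telescoping.recurrence (λ m → rhs-recurrence (suc m)) S≈rhs-1 S≈rhs-2 m

corollary8 : ∀ {c ℓ} (K : CharZeroField c ℓ) → let open FieldOps K in
    ∀ (n : ℕ) (x : Carrier) → ¬ (ι 6 * x - 1# ≈ 0#) →
      F32 (ι 3 * x) (1# - ι 3 * x) n (ι 3 / ι 2) (- (1# + ι 3 * ι n)) (ι 3 / ι 4)
        ≈ (ι 3 * x) / (ι 6 * x - 1#) * bracket2 (1# + x) (1# - x) (ι 2 / ι 3) (ι 4 / ι 3) n
          + (ι 3 * x - 1#) / (ι 6 * x - 1#)
            * bracket2 (ι 2 / ι 3 + x) (ι 4 / ι 3 - x) (ι 2 / ι 3) (ι 4 / ι 3) n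
corollary8 K n x w≉0 = S≈rhs K x w≉0 n
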